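{- Let $S \subseteq \{0,\dots,d\}$ be proper and $\mathsf{c}(\mathbf{x}) = x_1 + \cdots + x_d$. Then every $\mathsf{c}$-monotone path of $\Delta(d,S)$ is coherent.
   Context: For nonempty $S \subseteq \{0,1,\dots,d\}$, $\Delta(d,S) = \operatorname{conv}\{ \mathbf{v} \in \{0,1\}^d : v_1 + \cdots + v_d \in S\}$; $S$ is proper if $\Delta(d,S)$ is $d$-dimensional. For a polytope $P \subset \mathbb{R}^d$ and a linear function $\ell$, an $\ell$-monotone path is a sequence of vertices $W = \mathbf{v}_1,\dots,\mathbf{v}_m$ such that each $[\mathbf{v}_i,\mathbf{v}_{i+1}]$ is an edge of $P$ and $\min \ell(P) = \ell(\mathbf{v}_1) < \cdots < \ell(\mathbf{v}_m) = \max \ell(P)$. Such a path $W$ is coherent if there is a linear function $h_W : \mathbb{R}^d \to \mathbb{R}$ such that, for the projection $\pi(\mathbf{x}) = (\ell(\mathbf{x}), h_W(\mathbf{x}))$, the path $W$ is mapped onto one of the two monotone paths forming the boundary of the polygon $\pi(P)$ (i.e. $\pi(\mathbf{v}_1),\dots,\pi(\mathbf{v}_m)$ are, in order, the vertices of the upper or of the lower boundary chain of $\pi(P)$). -}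

module Defs where

open import Data.Bool using (Bool; true; false)
open import Data.Nat using (ℕ; zero; suc)
open import Data.Fin using (Fin; inject₁)
open import Data.Fin.Subset using (Subset; _∈_; Nonempty)
open import Data.Vec using (Vec; []; _∷_; replicate; map; lookup)
open import Data.List using (List; []; _∷_)
import Data.List
open import Data.List.NonEmpty using (List⁺; head; last; toList)
open import Data.List.Membership.Propositional renaming (_∈_ to _∈ₗ_)
open import Data.List.Relation.Unary.All using (All)
open import Data.List.Relation.Unary.Linked using (Linked)
open import Data.Rational using (ℚ; 0ℚ; 1ℚ; _+_; _*_; _-_; -_; _<_; _≤_)
open import Data.Product using (Σ; _×_; ∃; _,_; proj₁; proj₂)
open import Data.Sum using (_⊎_)
open import Data.Unit using (⊤)
open import Relation.Binary.PropositionalEquality using (_≡_; _≢_)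

-- Points of {0,1}^d (as Boolean vectors; true = coordinate 1).
Point : ℕ → Set
Point d = Vec Bool d

weight : ∀ {d} → Point d → Fin (suc d)
weight [] = Data.Fin.zero
weight (true ∷ v) = Data.Fin.suc (weight v)
weight (false ∷ v) = inject₁ (weight v)

-- Vertex set of Δ(d,S): the 0/1 points whose coordinate sum lies in S.
-- (Every such 0/1 point is a vertex of its convex hull.)
InΔ : (d : ℕ) → Subset (suc d) → Point d → Set
InΔ d S v = weight v ∈ S

Functional : ℕ → Set
Functional d = Vec ℚ d

eval : ∀ {d} → Functional d → Point d → ℚ
eval [] [] = 0ℚ
eval (a ∷ as) (true ∷ v) = a + eval as v
eval (a ∷ as) (false ∷ v) = eval as v

c : ∀ {d} → Point d → ℚ
c {d} = eval (replicate d 1ℚ)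

-- S is proper: Δ(d,S) is d-dimensional, i.e. not contained in any affine
-- hyperplane: every affine function a·x = b vanishing on Δ(d,S) (on its
-- vertices) has a = 0.
Proper : (d : ℕ) → Subset (suc d) → Set
Proper d S = (a : Functional d) (b : ℚ) →
  ((v : Point d) → InΔ d S v → eval a v ≡ b) →
  (i : Fin d) → lookup a i ≡ 0ℚ

IsEdge : (d : ℕ) → Subset (suc d) → Point d → Point d → Set
IsEdge d S u v =
  InΔ d S u × InΔ d S v × u ≢ v ×
  ∃ λ (a : Functional d) → eval a u ≡ eval a v ×
    ((w : Point d) → InΔ d S w → w ≢ u → w ≢ v → eval a w < eval a u)

IsCMonotonePath : (d : ℕ) → Subset (suc d) → List⁺ (Point d) → Set
IsCMonotonePath d S W =
  All (InΔ d S) (toList W) ×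
  Linked (IsEdge d S) (toList W) ×
  Linked (λ u v → c u < c v) (toList W) ×
  ((w : Point d) → InΔ d S w → c (head W) ≤ c w) ×
  ((w : Point d) → InΔ d S w → c w ≤ c (last W))

Pt2 : Set
Pt2 = ℚ × ℚ

-- w lies weakly below the line through p and q (p to the left of q).
WeaklyBelow : Pt2 → Pt2 → Pt2 → Set
WeaklyBelow (px , py) (qx , qy) (wx , wy) =
  (wy - py) * (qx - px) ≤ (qy - py) * (wx - px)

-- q lies strictly above the segment from p to r (p left of r).
StrictlyAbove : Pt2 → Pt2 → Pt2 → Set
StrictlyAbove (px , py) (rx , ry) (qx , qy) =
  (ry - py) * (qx - px) < (qy - py) * (rx - px)

Triples : {A : Set} → (A → A → A → Set) → List A → Set
Triples R (x ∷ y ∷ z ∷ zs) = R x y z × Triples R (y ∷ z ∷ zs)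
Triples R _ = ⊤

π : ∀ {d} → Functional d → Point d → Pt2
π h x = (c x , eval h x)

-- The images π(v₁),…,π(v_m) are, in order, the vertices of the upper
-- boundary chain of the polygon π(Δ(d,S)) = conv π(vertices):
--  * first coordinates strictly increase;
--  * every projected vertex π(w) lies weakly below the polyline
--    (below each segment over whose x-range it lies, and below the end
--    points if it has the same x-coordinate as them);
--  * each interior point is strictly above the segment joining its
--    neighbours (so all listed points are genuine vertices of the chain).
-- Together with the fact that the path starts at min c and ends at max c,
-- this says the polyline is exactly the upper hull of π(Δ(d,S)).
IsUpperChain : (d : ℕ) → Subset (suc d) → Functional d → List⁺ (Point d) → Set
IsUpperChain d S h W =
  Linked (λ p q → proj₁ p < proj₁ q) ps ×
  ((w : Point d) → InΔ d S w →
     Linked (λ p q → proj₁ p ≤ proj₁ (π h w) → proj₁ (π h w) ≤ proj₁ q →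
                     WeaklyBelow p q (π h w)) ps) ×
  ((w : Point d) → InΔ d S w → c w ≡ c (head W) → eval h w ≤ eval h (head W)) ×
  ((w : Point d) → InΔ d S w → c w ≡ c (last W) → eval h w ≤ eval h (last W)) ×
  Triples (λ p q r → StrictlyAbove p r q) ps
  where
  ps : List Pt2
  ps = Data.List.map (π h) (toList W)

IsLowerChain : (d : ℕ) → Subset (suc d) → Functional d → List⁺ (Point d) → Set
IsLowerChain d S h W = IsUpperChain d S (map -_ h) W

IsCoherent : (d : ℕ) → Subset (suc d) → List⁺ (Point d) → Set
IsCoherent d S W =
  ∃ λ (h : Functional d) → IsUpperChain d S h W ⊎ IsLowerChain d S h W

{-# OPTIONS --safe #-}
module Submission where

-- An edge [u, v] of Δ(d,S) with c u < c v has u ⊆ v: otherwise take i ∈ u ∖ v and k ∈ v ∖ u;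
-- then u′ = u − eᵢ + eₖ and v′ = v − eₖ + eᵢ are vertices of Δ(d,S) other than u and v with
-- u′ + v′ = u + v, so no functional is maximal exactly on {u, v}.
-- Hence a c-monotone path is a chain v₁ ⊂ ⋯ ⊂ v_m, and h = Σⱼ 1_{vⱼ} makes it coherent: in
--   h(x) − (m − k)·c(x) = Σ_{j ≤ k} |vⱼ ∩ x| + Σ_{j > k} (|vⱼ ∩ x| − |x|)
-- every summand is maximal over the whole cube both at vₖ and at vₖ₊₁. So consecutive projected
-- vertices lie on a common supporting line, of slope m − k, and these slopes strictly decrease.

open import Defs
open import Algebra.Bundles using (CommutativeMonoid)
open import Data.Bool using (true; false; if_then_else_)
open import Data.Fin using (Fin; toℕ; inject₁)
open import Data.Fin.Properties using (toℕ-inject₁; toℕ-injective)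
open import Data.Fin.Subset using (Subset; Nonempty; _∈_; _⊆_; _∩_)
open import Data.Fin.Subset.Properties
  using (⊆-refl; ⊆-trans; ⊆-antisym; drop-∷-⊆; out⊆; s⊆s; p∩q⊆p; p∩q⊆q; x∈p∩q⁺)
open import Data.List using (List; length; _∷ʳ_)
import Data.List as List
open import Data.List.NonEmpty using (List⁺; toList; last; snocView; _∷ʳ′_)
open import Data.List.Relation.Unary.All using (All)
open import Data.List.Relation.Unary.AllPairs using (AllPairs)
open import Data.List.Relation.Unary.Linked using (Linked)
import Data.List.Relation.Unary.Linked as Linked
open import Data.List.Relation.Unary.Linked.Properties using (map⁺; Linked⇒AllPairs)
open import Data.Nat using (ℕ; zero; suc)
open import Data.Product using (_×_; _,_; proj₁; proj₂; ∃; uncurry)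
import Data.Product as Product
open import Data.Rational
  using (ℚ; 0ℚ; 1ℚ; _+_; _*_; _-_; -_; _≤_; _<_; Positive; NonNegative; positive; nonNegative)
open import Data.Rational.Properties
open import Algebra.Properties.CommutativeSemigroup
  (CommutativeMonoid.commutativeSemigroup +-0-commutativeMonoid) using (interchange; x∙yz≈y∙xz)
open import Data.Sum using (_⊎_; inj₁; inj₂)
import Data.Sum as Sum
open import Data.Unit using (⊤; tt)
open import Data.Vec using (here; replicate; zipWith; map; lookup; _[_]≔_)
open import Data.Vec.Properties using (lookup∘update; lookup∘update′; []≔-idempotent; []≔-lookup)
open import Function using (_∘_; id)
open import Relation.Binary.PropositionalEquality
open import Relation.Nullary using (¬_; contradiction)
open import Relation.Nullary.Decidable using (dec⇒maybe)
open import Tactic.RingSolver using (solve; solve-∀)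
open import Tactic.RingSolver.Core.AlmostCommutativeRing using (AlmostCommutativeRing; fromCommutativeRing)
open import Data.List using ([]; _∷_)

-- Without the zero test the solver's normal forms are not unique and it fails.
ℚ-ring : AlmostCommutativeRing _ _
ℚ-ring = fromCommutativeRing +-*-commutativeRing (λ p → dec⇒maybe (0ℚ ≟ p))

p<1+p : ∀ p → p < 1ℚ + p
p<1+p p = begin-strict
  p        ≡⟨ +-identityˡ p ⟨
  0ℚ + p   <⟨ +-monoˡ-< p (positive⁻¹ 1ℚ) ⟩
  1ℚ + p   ∎
  where open ≤-Reasoning

p≤q⇒0≤q-p : ∀ {p q} → p ≤ q → 0ℚ ≤ q - p
p≤q⇒0≤q-p {p} {q} p≤q = begin
  0ℚ      ≡⟨ +-inverseʳ p ⟨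
  p - p   ≤⟨ +-monoˡ-≤ (- p) p≤q ⟩
  q - p   ∎
  where open ≤-Reasoning

p<q⇒0<q-p : ∀ {p q} → p < q → 0ℚ < q - p
p<q⇒0<q-p {p} {q} p<q = begin-strict
  0ℚ      ≡⟨ +-inverseʳ p ⟨
  p - p   <⟨ +-monoˡ-< (- p) p<q ⟩
  q - p   ∎
  where open ≤-Reasoning

+-swap : ∀ p q r s → (p + r) + (q + s) ≡ (q + r) + (p + s)
+-swap = solve-∀ ℚ-ring

bend-inequality : ∀ {σ τ a b} → 0ℚ < a → 0ℚ < b → τ < σ →
  (τ * b + σ * a) * a < σ * a * (a + b)
bend-inequality {σ} {τ} {a} {b} 0<a 0<b τ<σ = begin-strict
  (τ * b + σ * a) * a      ≡⟨ solve (σ ∷ τ ∷ a ∷ b ∷ []) ℚ-ring ⟩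
  τ * (b * a) + σ * a * a  <⟨ +-monoˡ-< (σ * a * a) (*-monoˡ-<-pos (b * a) τ<σ) ⟩
  σ * (b * a) + σ * a * a  ≡⟨ solve (σ ∷ a ∷ b ∷ []) ℚ-ring ⟩
  σ * a * (a + b)          ∎
  where
  open ≤-Reasoning
  instance
    _ : Positive (b * a)
    _ = pos*pos⇒pos b {{positive 0<b}} a {{positive 0<a}}

intercept : ℚ → Pt2 → ℚ
intercept σ (x , y) = y - σ * x

rise-≤ : ∀ σ p w → intercept σ w ≤ intercept σ p →
  proj₂ w - proj₂ p ≤ σ * (proj₁ w - proj₁ p)
rise-≤ σ (px , py) (wx , wy) w≤p = begin
  wy - py                        ≡⟨ solve (σ ∷ px ∷ py ∷ wx ∷ wy ∷ []) ℚ-ring ⟩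
  (wy - σ * wx) + (σ * wx - py)  ≤⟨ +-monoˡ-≤ (σ * wx - py) w≤p ⟩
  (py - σ * px) + (σ * wx - py)  ≡⟨ solve (σ ∷ px ∷ py ∷ wx ∷ []) ℚ-ring ⟩
  σ * (wx - px)                  ∎
  where open ≤-Reasoning

rise-≡ : ∀ σ p q → intercept σ q ≡ intercept σ p →
  proj₂ q - proj₂ p ≡ σ * (proj₁ q - proj₁ p)
rise-≡ σ (px , py) (qx , qy) q≡p = begin
  qy - py                        ≡⟨ solve (σ ∷ px ∷ py ∷ qx ∷ qy ∷ []) ℚ-ring ⟩
  (qy - σ * qx) + (σ * qx - py)  ≡⟨ cong (_+ (σ * qx - py)) q≡p ⟩
  (py - σ * px) + (σ * qx - py)  ≡⟨ solve (σ ∷ px ∷ py ∷ qx ∷ []) ℚ-ring ⟩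
  σ * (qx - px)                  ∎
  where open ≡-Reasoning

≤-of-same-abscissa : ∀ σ p w → intercept σ w ≤ intercept σ p →
  proj₁ w ≡ proj₁ p → proj₂ w ≤ proj₂ p
≤-of-same-abscissa σ (x , py) (.x , wy) w≤p refl = begin
  wy                    ≡⟨ solve (σ ∷ x ∷ wy ∷ []) ℚ-ring ⟩
  (wy - σ * x) + σ * x  ≤⟨ +-monoˡ-≤ (σ * x) w≤p ⟩
  (py - σ * x) + σ * x  ≡⟨ solve (σ ∷ x ∷ py ∷ []) ℚ-ring ⟩
  py                    ∎
  where open ≤-Reasoning

weaklyBelow-of-supporting : ∀ σ p q w → proj₁ p ≤ proj₁ q →
  intercept σ q ≡ intercept σ p → intercept σ w ≤ intercept σ p → WeaklyBelow p q w
weaklyBelow-of-supporting σ p@(px , py) q@(qx , qy) w@(wx , wy) px≤qx q≡p w≤p = begin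
  (wy - py) * (qx - px)      ≤⟨ *-monoʳ-≤-nonNeg (qx - px) (rise-≤ σ p w w≤p) ⟩
  σ * (wx - px) * (qx - px)  ≡⟨ solve (σ ∷ px ∷ qx ∷ wx ∷ []) ℚ-ring ⟩
  σ * (qx - px) * (wx - px)  ≡⟨ cong (_* (wx - px)) (rise-≡ σ p q q≡p) ⟨
  (qy - py) * (wx - px)      ∎
  where
  open ≤-Reasoning
  instance
    _ : NonNegative (qx - px)
    _ = nonNegative (p≤q⇒0≤q-p px≤qx)

strictlyAbove-of-bend : ∀ σ τ p q r → proj₁ p < proj₁ q → proj₁ q < proj₁ r → τ < σ →
  intercept σ q ≡ intercept σ p → intercept τ r ≡ intercept τ q → StrictlyAbove p r q
strictlyAbove-of-bend σ τ p@(px , py) q@(qx , qy) r@(rx , ry) px<qx qx<rx τ<σ q≡p r≡q =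
  begin-strict
    (ry - py) * (qx - px)
      ≡⟨ solve (px ∷ py ∷ qx ∷ qy ∷ ry ∷ []) ℚ-ring ⟩
    ((ry - qy) + (qy - py)) * (qx - px)
      ≡⟨ cong₂ (λ s t → (s + t) * (qx - px)) (rise-≡ τ q r r≡q) (rise-≡ σ p q q≡p) ⟩
    (τ * (rx - qx) + σ * (qx - px)) * (qx - px)
      <⟨ bend-inequality (p<q⇒0<q-p px<qx) (p<q⇒0<q-p qx<rx) τ<σ ⟩
    σ * (qx - px) * ((qx - px) + (rx - qx))
      ≡⟨ cong₂ _*_ (rise-≡ σ p q q≡p) (solve (px ∷ qx ∷ rx ∷ []) ℚ-ring) ⟨
    (qy - py) * (rx - px)
      ∎
  where open ≤-Reasoning

-- Imported only now: `solve` rejects variable lists built from overloaded constructors.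
open import Data.Fin using (zero; suc)
open import Data.List.NonEmpty using (_∷_)
open import Data.List.Relation.Unary.All using ([]; _∷_)
open import Data.List.Relation.Unary.AllPairs using ([]; _∷_)
open import Data.List.Relation.Unary.Linked using ([]; [-]; _∷_)
open import Data.Vec using ([]; _∷_)

private
  variable
    d : ℕ
    σ : ℚ
    u v x : Point d
    W L : List (Point d)
    h : Functional d

fromℕ : ℕ → ℚ
fromℕ zero    = 0ℚ
fromℕ (suc n) = 1ℚ + fromℕ n

fromℕ-suc-* : ∀ n p → fromℕ (suc n) * p ≡ p + fromℕ n * p
fromℕ-suc-* n p = trans (*-distribʳ-+ p 1ℚ (fromℕ n)) (cong (_+ fromℕ n * p) (*-identityˡ p))

-- Edges of Δ(d,S) increase in the inclusion order

c-mono : ∀ {p q : Point d} → p ⊆ q → c p ≤ c q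
c-mono {p = []}        {[]}        p⊆q = ≤-refl
c-mono {p = false ∷ p} {false ∷ q} p⊆q = c-mono (drop-∷-⊆ p⊆q)
c-mono {p = false ∷ p} {true ∷ q}  p⊆q = ≤-trans (c-mono (drop-∷-⊆ p⊆q)) (<⇒≤ (p<1+p (c q)))
c-mono {p = true ∷ p}  {false ∷ q} p⊆q = contradiction (p⊆q here) λ ()
c-mono {p = true ∷ p}  {true ∷ q}  p⊆q = +-monoʳ-≤ 1ℚ (c-mono (drop-∷-⊆ p⊆q))

c-weight : ∀ (x : Point d) → c x ≡ fromℕ (toℕ (weight x))
c-weight []          = refl
c-weight (true ∷ x)  = cong (1ℚ +_) (c-weight x)
c-weight (false ∷ x) = trans (c-weight x) (cong fromℕ (sym (toℕ-inject₁ (weight x))))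

⊆-or-∃∈∉ : ∀ {n} (p q : Subset n) → p ⊆ q ⊎ ∃ λ i → lookup p i ≡ true × lookup q i ≡ false
⊆-or-∃∈∉ []          []          = inj₁ ⊆-refl
⊆-or-∃∈∉ (false ∷ p) (_ ∷ q)     = Sum.map out⊆ (Product.map suc id) (⊆-or-∃∈∉ p q)
⊆-or-∃∈∉ (true ∷ p)  (true ∷ q)  = Sum.map s⊆s (Product.map suc id) (⊆-or-∃∈∉ p q)
⊆-or-∃∈∉ (true ∷ p)  (false ∷ q) = inj₂ (zero , refl , refl)

≢-at : ∀ {x y : Point d} i → lookup x i ≡ true → lookup y i ≡ false → x ≢ y
≢-at i xi yi refl = contradiction (trans (sym xi) yi) λ ()

eval-insert : ∀ (a : Functional d) y j → lookup y j ≡ false →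
  eval a (y [ j ]≔ true) ≡ lookup a j + eval a y
eval-insert (a ∷ as) (false ∷ y) zero    refl = refl
eval-insert (a ∷ as) (true ∷ y)  zero    ()
eval-insert (a ∷ as) (true ∷ y)  (suc j) yj   =
  trans (cong (a +_) (eval-insert as y j yj)) (x∙yz≈y∙xz a (lookup as j) (eval as y))
eval-insert (a ∷ as) (false ∷ y) (suc j) yj   = eval-insert as y j yj

toℕ-weight-insert : ∀ (y : Point d) j → lookup y j ≡ false →
  toℕ (weight (y [ j ]≔ true)) ≡ suc (toℕ (weight y))
toℕ-weight-insert (false ∷ y) zero    refl = cong suc (sym (toℕ-inject₁ (weight y)))
toℕ-weight-insert (true ∷ y)  zero    ()
toℕ-weight-insert (true ∷ y)  (suc j) yj   = cong suc (toℕ-weight-insert y j yj)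
toℕ-weight-insert (false ∷ y) (suc j) yj   = begin
  toℕ (inject₁ (weight (y [ j ]≔ true)))  ≡⟨ toℕ-inject₁ _ ⟩
  toℕ (weight (y [ j ]≔ true))            ≡⟨ toℕ-weight-insert y j yj ⟩
  suc (toℕ (weight y))                    ≡⟨ cong suc (toℕ-inject₁ (weight y)) ⟨
  suc (toℕ (inject₁ (weight y)))          ∎
  where open ≡-Reasoning

move : Fin d → Fin d → Point d → Point d
move i k x = (x [ i ]≔ false) [ k ]≔ true

module _ (x : Point d) (i k : Fin d) (xi : lookup x i ≡ true) (xk : lookup x k ≡ false) where

  private
    x₀ : Point d
    x₀ = x [ i ]≔ false

    i≢k : i ≢ k
    i≢k refl = contradiction (trans (sym xi) xk) λ ()

    x₀i : lookup x₀ i ≡ false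
    x₀i = lookup∘update i x false

    x₀k : lookup x₀ k ≡ false
    x₀k = trans (lookup∘update′ (≢-sym i≢k) x false) xk

    x₀-restore : x₀ [ i ]≔ true ≡ x
    x₀-restore = trans ([]≔-idempotent x i) (trans (cong (x [ i ]≔_) (sym xi)) ([]≔-lookup x i))

  eval-move : ∀ a → lookup a i + eval a (move i k x) ≡ lookup a k + eval a x
  eval-move a = begin
    lookup a i + eval a (x₀ [ k ]≔ true)   ≡⟨ cong (lookup a i +_) (eval-insert a x₀ k x₀k) ⟩
    lookup a i + (lookup a k + eval a x₀)  ≡⟨ x∙yz≈y∙xz (lookup a i) (lookup a k) (eval a x₀) ⟩
    lookup a k + (lookup a i + eval a x₀)  ≡⟨ cong (lookup a k +_) (eval-insert a x₀ i x₀i) ⟨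
    lookup a k + eval a (x₀ [ i ]≔ true)   ≡⟨ cong (λ y → lookup a k + eval a y) x₀-restore ⟩
    lookup a k + eval a x                  ∎
    where open ≡-Reasoning

  weight-move : weight (move i k x) ≡ weight x
  weight-move = toℕ-injective (begin
    toℕ (weight (x₀ [ k ]≔ true))  ≡⟨ toℕ-weight-insert x₀ k x₀k ⟩
    suc (toℕ (weight x₀))          ≡⟨ toℕ-weight-insert x₀ i x₀i ⟨
    toℕ (weight (x₀ [ i ]≔ true))  ≡⟨ cong (toℕ ∘ weight) x₀-restore ⟩
    toℕ (weight x)                 ∎)
    where open ≡-Reasoning

  c-move : c (move i k x) ≡ c x
  c-move = trans (c-weight (move i k x)) (trans (cong (fromℕ ∘ toℕ) weight-move) (sym (c-weight x)))

  lookup-move : lookup (move i k x) i ≡ false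
  lookup-move = trans (lookup∘update′ i≢k x₀ true) x₀i

¬edge-of-exchange : ∀ {S} {i k} → lookup u i ≡ true → lookup v i ≡ false →
  lookup v k ≡ true → lookup u k ≡ false → c u < c v → ¬ IsEdge d S u v
¬edge-of-exchange {d = d} {u = u} {v} {S} {i} {k} ui vi vk uk u<v
                  (u∈Δ , v∈Δ , _ , a , au≡av , a-max) =
  <-irrefl refl (begin-strict
    (lookup a k + eval a u) + (lookup a i + eval a v)
      ≡⟨ cong₂ _+_ (eval-move u i k ui uk a) (eval-move v k i vk vi a) ⟨
    (lookup a i + eval a u′) + (lookup a k + eval a v′)
      <⟨ +-mono-< (+-monoʳ-< (lookup a i) u′<u) (+-monoʳ-< (lookup a k) v′<v) ⟩
    (lookup a i + eval a u) + (lookup a k + eval a v)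
      ≡⟨ +-swap (lookup a i) (lookup a k) (eval a u) (eval a v) ⟩
    (lookup a k + eval a u) + (lookup a i + eval a v)
      ∎)
  where
  open ≤-Reasoning
  u′ v′ : Point d
  u′ = move i k u
  v′ = move k i v
  u′∈Δ : InΔ d S u′
  u′∈Δ = subst (_∈ S) (sym (weight-move u i k ui uk)) u∈Δ
  v′∈Δ : InΔ d S v′
  v′∈Δ = subst (_∈ S) (sym (weight-move v k i vk vi)) v∈Δ
  u′<u : eval a u′ < eval a u
  u′<u = a-max u′ u′∈Δ
    (≢-sym (≢-at i ui (lookup-move u i k ui uk)))
    (λ u′≡v → <-irrefl (trans (sym (c-move u i k ui uk)) (cong c u′≡v)) u<v)
  v′<v : eval a v′ < eval a v
  v′<v = subst (eval a v′ <_) au≡av (a-max v′ v′∈Δ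
    (λ v′≡u → <-irrefl (trans (sym (cong c v′≡u)) (c-move v k i vk vi)) u<v)
    (≢-at i (lookup∘update i (v [ k ]≔ false) true) vi))

edge⇒⊆ : ∀ {S} → IsEdge d S u v → c u < c v → u ⊆ v
edge⇒⊆ {u = u} {v} edge u<v with ⊆-or-∃∈∉ u v | ⊆-or-∃∈∉ v u
... | inj₁ u⊆v           | _                  = u⊆v
... | inj₂ _             | inj₁ v⊆u           = contradiction (<-≤-trans u<v (c-mono v⊆u)) (<-irrefl refl)
... | inj₂ (i , ui , vi) | inj₂ (k , vk , uk) = contradiction edge (¬edge-of-exchange ui vi vk uk u<v)

p⊆q⇒p∩q≡p : ∀ {p q : Point d} → p ⊆ q → p ∩ q ≡ p
p⊆q⇒p∩q≡p {p = p} {q} p⊆q = ⊆-antisym (p∩q⊆p p q) (λ x∈p → x∈p∩q⁺ (x∈p , p⊆q x∈p))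

q⊆p⇒p∩q≡q : ∀ {p q : Point d} → q ⊆ p → p ∩ q ≡ q
q⊆p⇒p∩q≡q {p = p} {q} q⊆p = ⊆-antisym (p∩q⊆q p q) (λ x∈q → x∈p∩q⁺ (q⊆p x∈q , x∈q))

indicator : Point d → Functional d
indicator = map (λ b → if b then 1ℚ else 0ℚ)

eval-indicator : ∀ (u x : Point d) → eval (indicator u) x ≡ c (u ∩ x)
eval-indicator []          []          = refl
eval-indicator (true ∷ u)  (true ∷ x)  = cong (1ℚ +_) (eval-indicator u x)
eval-indicator (true ∷ u)  (false ∷ x) = eval-indicator u x
eval-indicator (false ∷ u) (true ∷ x)  = trans (+-identityˡ _) (eval-indicator u x)
eval-indicator (false ∷ u) (false ∷ x) = eval-indicator u x

eval-zero : ∀ (x : Point d) → eval (replicate d 0ℚ) x ≡ 0ℚ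
eval-zero []          = refl
eval-zero (true ∷ x)  = trans (+-identityˡ _) (eval-zero x)
eval-zero (false ∷ x) = eval-zero x

eval-+ : ∀ (a b : Functional d) x → eval (zipWith _+_ a b) x ≡ eval a x + eval b x
eval-+ []       []       []          = sym (+-identityˡ 0ℚ)
eval-+ (a ∷ as) (b ∷ bs) (true ∷ x)  =
  trans (cong (a + b +_) (eval-+ as bs x)) (interchange a b (eval as x) (eval bs x))
eval-+ (a ∷ as) (b ∷ bs) (false ∷ x) = eval-+ as bs x

eval-indicator-+ : ∀ u h (x : Point d) →
  eval (zipWith _+_ (indicator u) h) x ≡ c (u ∩ x) + eval h x
eval-indicator-+ u h x = trans (eval-+ (indicator u) h x) (cong (_+ eval h x) (eval-indicator u x))

heights : List (Point d) → Functional d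
heights []      = replicate _ 0ℚ
heights (u ∷ W) = zipWith _+_ (indicator u) (heights W)

heights-≤ : ∀ W (x : Point d) → eval (heights W) x ≤ fromℕ (length W) * c x
heights-≤ []      x = ≤-reflexive (trans (eval-zero x) (sym (*-zeroˡ (c x))))
heights-≤ (u ∷ W) x = begin
  eval (heights (u ∷ W)) x        ≡⟨ eval-indicator-+ u (heights W) x ⟩
  c (u ∩ x) + eval (heights W) x  ≤⟨ +-mono-≤ (c-mono (p∩q⊆q u x)) (heights-≤ W x) ⟩
  c x + fromℕ (length W) * c x    ≡⟨ fromℕ-suc-* (length W) (c x) ⟨
  fromℕ (length (u ∷ W)) * c x    ∎
  where open ≤-Reasoning

heights-≡ : All (x ⊆_) W → eval (heights W) x ≡ fromℕ (length W) * c x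
heights-≡ {x = x} []                    = trans (eval-zero x) (sym (*-zeroˡ (c x)))
heights-≡ {x = x} {u ∷ W} (x⊆u ∷ x⊆W) = begin
  eval (heights (u ∷ W)) x        ≡⟨ eval-indicator-+ u (heights W) x ⟩
  c (u ∩ x) + eval (heights W) x  ≡⟨ cong₂ _+_ (cong c (q⊆p⇒p∩q≡q x⊆u)) (heights-≡ x⊆W) ⟩
  c x + fromℕ (length W) * c x    ≡⟨ fromℕ-suc-* (length W) (c x) ⟨
  fromℕ (length (u ∷ W)) * c x    ∎
  where open ≡-Reasoning

-- A record rather than a Π-type, so that h, σ and v can be inferred from a proof.
record Maximizes (h : Functional d) (σ : ℚ) (v : Point d) : Set where
  constructor maximizes
  field below : ∀ w → intercept σ (π h w) ≤ intercept σ (π h v)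
open Maximizes

heights-maximizes : All (x ⊆_) W → Maximizes (heights W) (fromℕ (length W)) x
heights-maximizes {x = x} {W = W} x⊆W = maximizes λ w → begin
  eval (heights W) w - n * c w  ≤⟨ +-monoˡ-≤ (- (n * c w)) (heights-≤ W w) ⟩
  n * c w - n * c w             ≡⟨ +-inverseʳ (n * c w) ⟩
  0ℚ                            ≡⟨ +-inverseʳ (n * c x) ⟨
  n * c x - n * c x             ≡⟨ cong (_- n * c x) (heights-≡ x⊆W) ⟨
  eval (heights W) x - n * c x  ∎
  where
  open ≤-Reasoning
  n = fromℕ (length W)

intercept-indicator-+ : ∀ σ u h (w : Point d) →
  intercept σ (π (zipWith _+_ (indicator u) h) w) ≡ c (u ∩ w) + intercept σ (π h w)
intercept-indicator-+ σ u h w =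
  trans (cong (_- σ * c w) (eval-indicator-+ u h w)) (+-assoc (c (u ∩ w)) _ _)

maximizes-+-indicator : u ⊆ x → Maximizes h σ x → Maximizes (zipWith _+_ (indicator u) h) σ x
maximizes-+-indicator {u = u} {x = x} {h = h} {σ = σ} u⊆x x-max = maximizes λ w → begin
  intercept σ (π (zipWith _+_ (indicator u) h) w)  ≡⟨ intercept-indicator-+ σ u h w ⟩
  c (u ∩ w) + intercept σ (π h w)                  ≤⟨ +-mono-≤ (c-mono (p∩q⊆p u w)) (below x-max w) ⟩
  c u + intercept σ (π h x)                        ≡⟨ cong (λ y → c y + intercept σ (π h x))
                                                           (p⊆q⇒p∩q≡p u⊆x) ⟨
  c (u ∩ x) + intercept σ (π h x)                  ≡⟨ intercept-indicator-+ σ u h x ⟨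
  intercept σ (π (zipWith _+_ (indicator u) h) x)  ∎
  where open ≤-Reasoning

Tangent : Functional d → ℕ → Point d → Set
Tangent h n v = Maximizes h (fromℕ n) v × Maximizes h (fromℕ (suc n)) v

-- A vertex followed by n further vertices of the path supports the slopes n and n + 1, so
-- consecutive vertices share a supporting line and the slope drops by one at each vertex.
Supported : Functional d → List (Point d) → Set
Supported h []      = ⊤
Supported h (v ∷ L) = Tangent h (length L) v × Supported h L

supported-+-indicator : All (u ⊆_) L → Supported h L → Supported (zipWith _+_ (indicator u) h) L
supported-+-indicator []            _                = tt
supported-+-indicator (u⊆v ∷ u⊆L) ((m , m′) , s) =
  (maximizes-+-indicator u⊆v m , maximizes-+-indicator u⊆v m′) , supported-+-indicator u⊆L s

heights-supported : AllPairs _⊆_ W → Supported (heights W) W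
heights-supported []              = tt
heights-supported (u⊆L ∷ chain) =
  (maximizes-+-indicator ⊆-refl (heights-maximizes u⊆L) , heights-maximizes (⊆-refl ∷ u⊆L)) ,
  supported-+-indicator u⊆L (heights-supported chain)

tangent-last : ∀ ys {y : Point d} → Supported h (ys ∷ʳ y) → Tangent h 0 y
tangent-last []       (t , _) = t
tangent-last (_ ∷ ys) (_ , s) = tangent-last ys s

tangent-last⁺ : ∀ (W : List⁺ (Point d)) → Supported h (toList W) → Tangent h 0 (last W)
tangent-last⁺ W s with snocView W
... | []       ∷ʳ′ y = proj₁ s
... | (x ∷ xs) ∷ʳ′ y = tangent-last (x ∷ xs) s

-- The projected path is the upper boundary chain

common-line : Maximizes h σ u → Maximizes h σ v → intercept σ (π h v) ≡ intercept σ (π h u)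
common-line u-max v-max = ≤-antisym (below u-max _) (below v-max _)

weaklyBelow-path : ∀ L → Supported h L → Linked (λ u v → c u < c v) L → ∀ w →
  Linked (λ p q → WeaklyBelow p q (π h w)) (List.map (π h) L)
weaklyBelow-path []       _ _ w = []
weaklyBelow-path (u ∷ []) _ _ w = [-]
weaklyBelow-path {h = h} (u ∷ v ∷ L) ((u-max , _) , s@((_ , v-max) , _)) (u<v ∷ increasing) w =
  weaklyBelow-of-supporting (fromℕ (length (v ∷ L))) (π h u) (π h v) (π h w)
    (<⇒≤ u<v) (common-line u-max v-max) (below u-max w)
  ∷ weaklyBelow-path (v ∷ L) s increasing w

strictlyAbove-path : ∀ L → Supported h L → Linked (λ u v → c u < c v) L →
  Triples (λ p q r → StrictlyAbove p r q) (List.map (π h) L)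
strictlyAbove-path []           _ _ = tt
strictlyAbove-path (_ ∷ [])     _ _ = tt
strictlyAbove-path (_ ∷ _ ∷ []) _ _ = tt
strictlyAbove-path {h = h} (p ∷ q ∷ r ∷ L)
  ((p-max , _) , s@((q-max , q-max′) , ((_ , r-max′) , _))) (p<q ∷ increasing@(q<r ∷ _)) =
  strictlyAbove-of-bend (fromℕ (length (q ∷ r ∷ L))) (fromℕ (length (r ∷ L)))
    (π h p) (π h q) (π h r) p<q q<r (p<1+p _)
    (common-line p-max q-max′) (common-line q-max r-max′)
  , strictlyAbove-path (q ∷ r ∷ L) s increasing

isUpperChain : ∀ {S} (W : List⁺ (Point d)) → Supported h (toList W) →
  Linked (λ u v → c u < c v) (toList W) → IsUpperChain d S h W
isUpperChain {h = h} W@(x ∷ xs) s increasing =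
  map⁺ increasing ,
  (λ w _ → Linked.map (λ wb _ _ → wb) (weaklyBelow-path (x ∷ xs) s increasing w)) ,
  (λ w _ → ≤-of-same-abscissa (fromℕ (length xs)) (π h x) (π h w) (below (proj₁ (proj₁ s)) w)) ,
  (λ w _ → ≤-of-same-abscissa 0ℚ (π h (last W)) (π h w) (below (proj₁ (tangent-last⁺ W s)) w)) ,
  strictlyAbove-path (x ∷ xs) s increasing

proposition4p2 : (d : ℕ) (S : Subset (suc d)) → Nonempty S → Proper d S →
    (W : List⁺ (Point d)) → IsCMonotonePath d S W → IsCoherent d S W
proposition4p2 d S _ _ W (_ , edges , increasing , _ , _) =
  heights (toList W) , inj₁ (isUpperChain W (heights-supported chain) increasing)
  where
  chain : AllPairs _⊆_ (toList W)
  chain = Linked⇒AllPairs ⊆-trans (Linked.zipWith (uncurry edge⇒⊆) (edges , increasing))
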